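{- (a) There exist a finite alphabet $A$, $n\ge1$ and an $n$-variable weakly regular predicate $P$ over $A$ such that $\neg P$ (the complement of its language in $(A^\ast)^n$) is not weakly regular. (b) For every finite alphabet $A$, $n\ge1$ and $n$-variable weakly regular predicates $P,Q$ over $A$, the predicate $P\vee Q$ (union of the languages) is weakly regular. (c) There exist $A$, $n$ and $n$-variable weakly regular predicates $P,Q$ over $A$ such that $P\wedge Q$ (intersection) is not weakly regular. (d) For every finite alphabet $A$, $n\ge2$ and $n$-variable weakly regular predicate $P$ over $A$, the predicate $(\exists x_1)P(x_1,\dots,x_n)$ is weakly regular. (e) There exist $A$, $n\ge 2$ and an $n$-variable weakly regular predicate $P$ over $A$ such that $(\forall x_1)P(x_1,\dots,x_n)$ is not weakly regular.
   Context: An $n$-variable predicate over $A$ is identified with the set $L\subseteq(A^\ast)^n$ where it holds. $(\exists x_1)P=\{(x_2,\dots,x_n):\exists x_1\in A^\ast,\ P(x_1,\dots,x_n)\}$ and $(\forall x_1)P=\{(x_2,\dots,x_n):\forall x_1\in A^\ast,\ P(x_1,\dots,x_n)\}$. Let $\$\notin A$. A non-deterministic semi-sorted asynchronous automaton (SAA) over $A$ is a non-deterministic finite state automaton over $A\sqcup\{\$\}$ (possibly several start states, several transitions per letter, $\epsilon$-transitions allowed) together with a partition of its state set into $S_1,\dots,S_n$; it accepts $(w_1,\dots,w_n)$ iff there is a path from a start state to an accept state such that for each $i$ the concatenation of the non-$\epsilon$ labels of transitions whose source lies in $S_i$ equals $w_i\$$. A predicate is weakly regular if its language is accepted by an SAA.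 -}

module Defs where

open import Data.Nat using (ℕ; suc)
open import Data.Fin using (Fin; _≟_)
open import Data.Bool using (Bool; T)
open import Data.Maybe using (Maybe; just; nothing)
open import Data.List using (List; []; _∷_; map; _++_; [_])
open import Data.Vec using (Vec; lookup; _∷_)
open import Data.Product using (Σ; ∃; _×_; _,_)
open import Data.Sum using (_⊎_)
open import Relation.Nullary using (¬_; yes; no)
open import Relation.Binary.PropositionalEquality using (_≡_)
open import Function.Bundles using (_⇔_)

Word : ℕ → Set
Word k = List (Fin k)

-- Letters of A ⊔ {$}:  just a  is the letter a ∈ A,  nothing  is the end marker $.
Letter : ℕ → Set
Letter k = Maybe (Fin k)

Predicate : ℕ → ℕ → Set₁
Predicate k n = Vec (Word k) n → Set

-- Non-deterministic semi-sorted asynchronous automaton over Fin k with n sorts.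
-- States: Fin m.  Transition labels: nothing = ε, just ℓ = letter ℓ of A ⊔ {$}.
-- part q = i  means  q ∈ S_i.
record SAA (k n : ℕ) : Set where
  field
    m      : ℕ
    start  : Fin m → Bool
    accept : Fin m → Bool
    trans  : Fin m → Maybe (Letter k) → Fin m → Bool
    part   : Fin m → Fin n

data Run {k n : ℕ} (M : SAA k n) : Fin (SAA.m M) → Fin (SAA.m M) → List (Fin n × Letter k) → Set where
  stop  : ∀ {q} → Run M q q []
  stepε : ∀ {q q' r t} → T (SAA.trans M q nothing q') → Run M q' r t → Run M q r t
  step  : ∀ {q q' r t} (a : Letter k) → T (SAA.trans M q (just a) q') → Run M q' r t →
          Run M q r ((SAA.part M q , a) ∷ t)

project : {k n : ℕ} → Fin n → List (Fin n × Letter k) → List (Letter k)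
project i [] = []
project i ((j , a) ∷ t) with j ≟ i
... | yes _ = a ∷ project i t
... | no  _ = project i t

Accepts : {k n : ℕ} → SAA k n → Vec (Word k) n → Set
Accepts {k} {n} M w =
  Σ (Fin (SAA.m M)) λ q → Σ (Fin (SAA.m M)) λ r → Σ (List (Fin n × Letter k)) λ t →
    T (SAA.start M q) × T (SAA.accept M r) × Run M q r t ×
    ((i : Fin n) → project i t ≡ map just (lookup w i) ++ [ nothing ])

WeaklyRegular : {k n : ℕ} → Predicate k n → Set
WeaklyRegular {k} {n} P = Σ (SAA k n) λ M → (w : Vec (Word k) n) → P w ⇔ Accepts M w

Not : {k n : ℕ} → Predicate k n → Predicate k n
Not P w = ¬ P w

Or : {k n : ℕ} → Predicate k n → Predicate k n → Predicate k n
Or P Q w = P w ⊎ Q w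

And : {k n : ℕ} → Predicate k n → Predicate k n → Predicate k n
And P Q w = P w × Q w

Exists₁ : {k n : ℕ} → Predicate k (suc n) → Predicate k n
Exists₁ {k} P v = Σ (Word k) λ x → P (x ∷ v)

Forall₁ : {k n : ℕ} → Predicate k (suc n) → Predicate k n
Forall₁ {k} P v = (x : Word k) → P (x ∷ v)

module Submission where

-- The positive parts (b) and (d) are automaton constructions: the disjoint
-- union of two SAAs recognises the disjunction, and for (∃x₁)P an SAA runs
-- the automaton for P while guessing the letters of x₁, so that its moves on
-- the first tape become ε-moves.
--
-- The negative parts (a), (c) and (e) all reduce to one non-weakly-regular
-- predicate over {a, b}: Balanced(y, z) ⇔ #a(y) = |z| = #b(y).  By a
-- pumping argument (an accepting run revisits a state within its first m
-- labelled steps, and the loop can be cut out) an SAA with m states accepting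
-- (aᵐbᵐ, aᵐ) also accepts a pair obtained by deleting a's from the front of
-- its components, which is no longer balanced.  Each counterexample is then
-- built from two small explicit SAAs, for #c(y) ≠ |z| and for
-- "u = [] (or u ≠ []) and #c(y) = |z|", by the constructions of (b) and (d),
-- and its complement, conjunction or universal closure is equivalent to
-- Balanced.

open import Defs
open import Data.Nat using (ℕ; zero; suc; _+_; _≤_; _<_; z≤n; s≤s) renaming (_≟_ to _≟ℕ_)
open import Data.Nat.Properties
  using (≤-trans; ≤-reflexive; <-irrefl; <⇒≢; 1+n≢0; suc-injective; +-identityʳ; +-suc; +-mono-≤;
         m≤n⇒m≤1+n; n<1+n; m⊓n≤m; +-comm; +-cancelʳ-≡; m≤n⇒∃[o]m+o≡n)
open import Data.Fin using (Fin; zero; suc; toℕ; _≟_; splitAt; join) renaming (_<_ to _<ᶠ_)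
open import Data.Fin.Properties using (pigeonhole; toℕ≤pred[n]; splitAt-join) renaming (any? to anyFin?)
open import Data.List.Relation.Unary.Any using (here; there; any?)
open import Data.List.Membership.Propositional using (_∈_)
open import Data.Bool using (Bool; true; false; T; if_then_else_; not; _∧_; _∨_)
open import Data.Bool.Properties using (T-∧; T-∨)
open import Data.Unit using (tt)
open import Data.Maybe using (Maybe; just; nothing)
open import Data.Maybe.Properties using (just-injective)
open import Data.List using (List; []; _∷_; map; _++_; [_]; length; take; drop; replicate; catMaybes)
open import Data.List.Properties
  using (++-assoc; ++-identityʳ; map-++; map-replicate; length-++; length-take;
         length-replicate; length-++-≤ˡ; take++drop≡id; drop-drop; ∷-injectiveˡ; ∷-injectiveʳ)
open import Data.List.Relation.Unary.All using (All; []; _∷_)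
open import Data.List.Relation.Unary.All.Properties using (++⁻)
open import Data.Vec using (Vec; lookup; tabulate; _∷_; _[_]%=_) renaming ([] to [])
import Data.Vec
open import Data.Vec.Properties
  using (lookup∘tabulate; lookup∘updateAt; lookup∘updateAt′; lookup-map; lookup-replicate)
open import Data.Product using (Σ; ∃; _×_; _,_; proj₁; proj₂)
open import Data.Sum using (_⊎_; inj₁; inj₂; [_,_]′)
import Data.Sum
open import Data.Empty using (⊥-elim)
open import Relation.Nullary using (¬_; Dec; yes; no; does)
open import Relation.Nullary.Decidable using (isYes; toWitness; fromWitness; T?; decidable-stable)
open import Relation.Binary.PropositionalEquality
  using (_≡_; _≢_; refl; sym; trans; cong; cong₂; subst; subst₂; module ≡-Reasoning)
open import Function.Base using (_∘_)
open import Function.Bundles using (_⇔_; mk⇔; Equivalence)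

private
  variable
    k n : ℕ

Trace : ℕ → ℕ → Set
Trace k n = List (Fin n × Letter k)

spell : Word k → List (Letter k)
spell w = map just w ++ [ nothing ]

project-here : (i : Fin n) (a : Letter k) (t : Trace k n) →
               project i ((i , a) ∷ t) ≡ a ∷ project i t
project-here i a t with i ≟ i
... | yes _ = refl
... | no i≢i = ⊥-elim (i≢i refl)

project-miss : {i j : Fin n} (a : Letter k) (t : Trace k n) → j ≢ i → project i ((j , a) ∷ t) ≡ project i t
project-miss {i = i} {j} a t j≢i with j ≟ i
... | yes j≡i = ⊥-elim (j≢i j≡i)
... | no _ = refl

project-++ : (i : Fin n) (t u : Trace k n) → project i (t ++ u) ≡ project i t ++ project i u
project-++ i [] u = refl
project-++ i ((j , a) ∷ t) u with j ≟ i
... | yes _ = cong (a ∷_) (project-++ i t u)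
... | no _ = project-++ i t u

project-length : (i : Fin n) (t : Trace k n) → length (project i t) ≤ length t
project-length i [] = z≤n
project-length i ((j , a) ∷ t) with j ≟ i
... | yes _ = s≤s (project-length i t)
... | no _ = m≤n⇒m≤1+n (project-length i t)

nonempty-projection : (t : Trace k n) → t ≢ [] → ∃ λ i → 0 < length (project i t)
nonempty-projection [] t≢[] = ⊥-elim (t≢[] refl)
nonempty-projection ((j , a) ∷ t) _ =
  j , subst (λ l → 0 < length l) (sym (project-here j a t)) (s≤s z≤n)

spelled-length : (i : Fin n) {t : Trace k n} {w : Word k} → project i t ≡ spell w → length w ≤ length t
spelled-length i {t} {w} spells =
  ≤-trans (letters w) (subst (λ l → length l ≤ length t) spells (project-length i t))
  where
  letters : (w : Word k) → length w ≤ length (spell w)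
  letters [] = z≤n
  letters (x ∷ w) = s≤s (letters w)

_++ᴿ_ : {M : SAA k n} {q s r : Fin (SAA.m M)} {t u : Trace k n} →
        Run M q s t → Run M s r u → Run M q r (t ++ u)
stop ++ᴿ σ = σ
stepε e ρ ++ᴿ σ = stepε e (ρ ++ᴿ σ)
step a e ρ ++ᴿ σ = step a e (ρ ++ᴿ σ)

cut : {M : SAA k n} {q r : Fin (SAA.m M)} {u : Trace k n} → Run M q r u → (i : ℕ) →
      Σ (Fin (SAA.m M)) λ s → Run M q s (take i u) × Run M s r (drop i u)
cut {q = q} ρ zero = q , stop , ρ
cut {r = r} stop (suc i) = r , stop , stop
cut (stepε e ρ) (suc i) with cut ρ (suc i)
... | s , ρ₁ , ρ₂ = s , stepε e ρ₁ , ρ₂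
cut (step a e ρ) (suc i) with cut ρ i
... | s , ρ₁ , ρ₂ = s , step a e ρ₁ , ρ₂

-- The loop lemma: a run with at least as many labelled steps as there are
-- states revisits a state within its first m steps; cutting out the loop in
-- between leaves a run between the same states.
record Loop {k n : ℕ} (M : SAA k n) (q r : Fin (SAA.m M)) (u : Trace k n) : Set where
  field
    before loop after : Trace k n
    decomposition     : u ≡ before ++ loop ++ after
    loop-nonempty     : loop ≢ []
    loop-early        : length (before ++ loop) ≤ SAA.m M
    shortcut          : Run M q r (before ++ after)

take-drop-nonempty : {A : Set} (a d : ℕ) (u : List A) → a < length u → take (suc d) (drop a u) ≢ []
take-drop-nonempty zero d (x ∷ u) _ ()
take-drop-nonempty (suc a) d (x ∷ u) (s≤s a<u) = take-drop-nonempty a d u a<u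

-- By pigeonhole two of the states reached after 0, 1, …, m labelled steps,
-- say after a < b steps, coincide; the loop is the part of the trace between.
loop-lemma : {M : SAA k n} {q r : Fin (SAA.m M)} {u : Trace k n} →
             Run M q r u → SAA.m M ≤ length u → Loop M q r u
loop-lemma {M = M} {q} {r} {u} ρ m≤|u| = record
  { before        = take a u
  ; loop          = take d (drop a u)
  ; after         = drop d (drop a u)
  ; decomposition = sym (trans (cong (take a u ++_) (take++drop≡id d (drop a u))) (take++drop≡id a u))
  ; loop-nonempty = take-drop-nonempty a o u (≤-trans a<b (≤-trans b≤m m≤|u|))
  ; loop-early    = ≤-trans (≤-reflexive (length-++ (take a u)))
                            (≤-trans (+-mono-≤ (taken a u) (taken d (drop a u))) (subst (_≤ m) b≡a+d b≤m))
  ; shortcut      = proj₁ (proj₂ (cut ρ a)) ++ᴿ loop-skipped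
  }
  where
  open SAA M using (m)
  stateAfter : Fin (suc m) → Fin m
  stateAfter i = proj₁ (cut ρ (toℕ i))
  collision : ∃ λ i → ∃ λ j → i <ᶠ j × stateAfter i ≡ stateAfter j
  collision = pigeonhole (n<1+n m) stateAfter
  a b : ℕ
  a = toℕ (proj₁ collision)
  b = toℕ (proj₁ (proj₂ collision))
  a<b : a < b
  a<b = proj₁ (proj₂ (proj₂ collision))
  b≤m : b ≤ m
  b≤m = toℕ≤pred[n] (proj₁ (proj₂ collision))
  o d : ℕ
  o = proj₁ (m≤n⇒∃[o]m+o≡n a<b)
  d = suc o
  b≡a+d : b ≡ a + d
  b≡a+d = trans (sym (proj₂ (m≤n⇒∃[o]m+o≡n a<b))) (sym (+-suc a o))
  taken : ∀ x (v : Trace _ _) → length (take x v) ≤ x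
  taken x v = ≤-trans (≤-reflexive (length-take x v)) (m⊓n≤m x _)
  loop-skipped : Run M (proj₁ (cut ρ a)) r (drop d (drop a u))
  loop-skipped = subst (λ s → Run M s r (drop d (drop a u))) (sym (proj₂ (proj₂ (proj₂ collision))))
                   (subst (Run M _ r) (trans (cong (λ x → drop x u) b≡a+d) (sym (drop-drop a d u)))
                     (proj₂ (proj₂ (cut ρ b))))

replicate-+ : {A : Set} (p s : ℕ) (x : A) → replicate (p + s) x ≡ replicate p x ++ replicate s x
replicate-+ zero s x = refl
replicate-+ (suc p) s x = cong (x ∷_) (replicate-+ p s x)

copies : {A : Set} {x : A} (xs : List A) → All (_≡ x) xs → xs ≡ replicate (length xs) x
copies [] [] = refl
copies (_ ∷ xs) (refl ∷ c) = cong (_ ∷_) (copies xs c)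

copies-commute : {A : Set} {x : A} {xs ys : List A} → All (_≡ x) xs → All (_≡ x) ys →
                 xs ++ ys ≡ ys ++ xs
copies-commute {x = x} {xs} {ys} cx cy = begin
  xs ++ ys                                          ≡⟨ cong₂ _++_ (copies xs cx) (copies ys cy) ⟩
  replicate (length xs) x ++ replicate (length ys) x ≡⟨ sym (replicate-+ (length xs) _ x) ⟩
  replicate (length xs + length ys) x                ≡⟨ cong (λ l → replicate l x) (+-comm (length xs) _) ⟩
  replicate (length ys + length xs) x                ≡⟨ replicate-+ (length ys) _ x ⟩
  replicate (length ys) x ++ replicate (length xs) x ≡⟨ sym (cong₂ _++_ (copies ys cy) (copies xs cx)) ⟩
  ys ++ xs                                          ∎
  where open ≡-Reasoning

prefix-copies : {A : Set} {x : A} (N : ℕ) (xs ys zs : List A) →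
                xs ++ ys ≡ replicate N x ++ zs → length xs ≤ N → All (_≡ x) xs
prefix-copies N [] ys zs e short = []
prefix-copies (suc N) (y ∷ xs) ys zs e (s≤s short) =
  ∷-injectiveˡ e ∷ prefix-copies N xs ys zs (∷-injectiveʳ e) short

strip-prefix : (v w : Word k) (L : List (Letter k)) → map just v ++ L ≡ spell w →
               Σ (Word k) λ w' → L ≡ spell w' × w ≡ v ++ w'
strip-prefix [] w L e = w , e , refl
strip-prefix (x ∷ v) [] L e with ∷-injectiveˡ e
... | ()
strip-prefix (x ∷ v) (y ∷ w) L e with just-injective (∷-injectiveˡ e) | strip-prefix v w L (∷-injectiveʳ e)
... | refl | w' , L≡ , w≡ = w' , L≡ , cong (x ∷_) w≡

delete-block : (a : Fin k) (N : ℕ) (v w : Word k) (B L C : List (Letter k)) →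
               w ≡ replicate N a ++ v → B ++ L ++ C ≡ spell w → length (B ++ L) ≤ N →
               Σ (Word k) λ w' → B ++ C ≡ spell w' × w ≡ replicate (length L) a ++ w'
delete-block a N v w B L C w≡ spelled short = strip-prefix (replicate (length L) a) w (B ++ C) moved
  where
  open ≡-Reasoning
  tape : (B ++ L) ++ C ≡ replicate N (just a) ++ spell v
  tape = begin
    (B ++ L) ++ C                                         ≡⟨ ++-assoc B L C ⟩
    B ++ L ++ C                                           ≡⟨ spelled ⟩
    spell w                                               ≡⟨ cong spell w≡ ⟩
    spell (replicate N a ++ v)                            ≡⟨ cong (_++ [ nothing ]) (map-++ just (replicate N a) v) ⟩
    (map just (replicate N a) ++ map just v) ++ [ nothing ] ≡⟨ ++-assoc (map just (replicate N a)) _ _ ⟩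
    map just (replicate N a) ++ spell v                   ≡⟨ cong (_++ spell v) (map-replicate just N a) ⟩
    replicate N (just a) ++ spell v                       ∎
  B-and-L-copies : All (_≡ just a) B × All (_≡ just a) L
  B-and-L-copies = ++⁻ B (prefix-copies N (B ++ L) C _ tape short)
  moved : map just (replicate (length L) a) ++ B ++ C ≡ spell w
  moved = begin
    map just (replicate (length L) a) ++ B ++ C ≡⟨ cong (_++ B ++ C) (trans (map-replicate just (length L) a)
                                                                    (sym (copies L (proj₂ B-and-L-copies)))) ⟩
    L ++ B ++ C                                 ≡⟨ sym (++-assoc L B C) ⟩
    (L ++ B) ++ C                               ≡⟨ cong (_++ C) (copies-commute (proj₂ B-and-L-copies)
                                                                                (proj₁ B-and-L-copies)) ⟩
    (B ++ L) ++ C                               ≡⟨ ++-assoc B L C ⟩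
    B ++ L ++ C                                 ≡⟨ spelled ⟩
    spell w                                     ∎

-- If M, with m states, accepts a tuple w each of whose
-- components begins with aᵐ, then deleting a block aᵖⁱ from the front of
-- each component, with the pᵢ not all zero, gives a tuple M still accepts:
-- the deleted letters are the projections of a loop within the first m steps.
record PumpedDown {k n : ℕ} (M : SAA k (suc n)) (a : Fin k) (w : Vec (Word k) (suc n)) : Set where
  field
    deleted  : Fin (suc n) → ℕ
    shrinks  : ∃ λ i → 0 < deleted i
    smaller  : Vec (Word k) (suc n)
    accepted : Accepts M smaller
    shifted  : ∀ i → lookup w i ≡ replicate (deleted i) a ++ lookup smaller i

pump-down : {k n : ℕ} (M : SAA k (suc n)) (a : Fin k) (w : Vec (Word k) (suc n)) →
            (∀ i → Σ (Word k) λ v → lookup w i ≡ replicate (SAA.m M) a ++ v) → Accepts M w → PumpedDown M a w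
pump-down {k} {n} M a w begins-with-a (q , r , u , q-start , r-accept , ρ , spells) = record
  { deleted  = p
  ; shrinks  = nonempty-projection loop loop-nonempty
  ; smaller  = tabulate w'
  ; accepted = q , r , before ++ after , q-start , r-accept , shortcut , λ i → begin
      project i (before ++ after)         ≡⟨ project-++ i before after ⟩
      project i before ++ project i after ≡⟨ proj₁ (proj₂ (deletion i)) ⟩
      spell (w' i)                        ≡⟨ cong spell (sym (lookup∘tabulate w' i)) ⟩
      spell (lookup (tabulate w') i)      ∎
  ; shifted  = λ i → trans (proj₂ (proj₂ (deletion i))) (cong (replicate (p i) a ++_) (sym (lookup∘tabulate w' i)))
  }
  where
  open ≡-Reasoning
  open SAA M using (m)
  -- the first component alone makes the trace at least m long
  long : m ≤ length u
  long = ≤-trans (subst (λ x → m ≤ length x) (sym (proj₂ (begins-with-a zero)))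
                   (≤-trans (≤-reflexive (sym (length-replicate m))) (length-++-≤ˡ (replicate m a))))
                 (spelled-length zero {t = u} (spells zero))
  open Loop (loop-lemma {M = M} ρ long)
  p : Fin (suc n) → ℕ
  p i = length (project i loop)
  spells-split : ∀ i → project i before ++ project i loop ++ project i after ≡ spell (lookup w i)
  spells-split i = begin
    project i before ++ project i loop ++ project i after ≡⟨ cong (project i before ++_) (sym (project-++ i loop after)) ⟩
    project i before ++ project i (loop ++ after)         ≡⟨ sym (project-++ i before (loop ++ after)) ⟩
    project i (before ++ loop ++ after)                   ≡⟨ cong (project i) (sym decomposition) ⟩
    project i u                                           ≡⟨ spells i ⟩
    spell (lookup w i)                                    ∎
  early : ∀ i → length (project i before ++ project i loop) ≤ m
  early i = ≤-trans (≤-reflexive (cong length (sym (project-++ i before loop))))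
                    (≤-trans (project-length i (before ++ loop)) loop-early)
  deletion : ∀ i → Σ (Word k) λ w' → project i before ++ project i after ≡ spell w' ×
                                     lookup w i ≡ replicate (p i) a ++ w'
  deletion i = delete-block a m (proj₁ (begins-with-a i)) (lookup w i) (project i before) (project i loop)
                 (project i after) (proj₂ (begins-with-a i)) (spells-split i) (early i)
  w' : Fin (suc n) → Word k
  w' i = proj₁ (deletion i)

occ : Fin k → Word k → ℕ
occ c [] = 0
occ c (x ∷ w) = if does (c ≟ x) then suc (occ c w) else occ c w

occ-hit : (c : Fin k) (w : Word k) → occ c (c ∷ w) ≡ suc (occ c w)
occ-hit c w with c ≟ c
... | yes _ = refl
... | no c≢c = ⊥-elim (c≢c refl)

occ-miss : {c x : Fin k} (w : Word k) → c ≢ x → occ c (x ∷ w) ≡ occ c w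
occ-miss {c = c} {x} w c≢x with c ≟ x
... | yes c≡x = ⊥-elim (c≢x c≡x)
... | no _ = refl

occ-++ : (c : Fin k) (u v : Word k) → occ c (u ++ v) ≡ occ c u + occ c v
occ-++ c [] v = refl
occ-++ c (x ∷ u) v with does (c ≟ x)
... | true = cong suc (occ-++ c u v)
... | false = occ-++ c u v

occ-replicate-hit : (c : Fin k) (p : ℕ) → occ c (replicate p c) ≡ p
occ-replicate-hit c zero = refl
occ-replicate-hit c (suc p) = trans (occ-hit c (replicate p c)) (cong suc (occ-replicate-hit c p))

occ-replicate-miss : {c x : Fin k} (p : ℕ) → c ≢ x → occ c (replicate p x) ≡ 0
occ-replicate-miss zero c≢x = refl
occ-replicate-miss (suc p) c≢x = trans (occ-miss (replicate p _) c≢x) (occ-replicate-miss p c≢x)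

occ-block-hit : {c : Fin k} {p : ℕ} {w : Word k} (w' : Word k) → w ≡ replicate p c ++ w' → occ c w ≡ p + occ c w'
occ-block-hit {c = c} {p} w' refl =
  trans (occ-++ c (replicate p c) w') (cong (_+ occ c w') (occ-replicate-hit c p))

occ-block-miss : {c x : Fin k} {p : ℕ} {w : Word k} (w' : Word k) → c ≢ x →
                 w ≡ replicate p x ++ w' → occ c w ≡ occ c w'
occ-block-miss {c = c} {p = p} w' c≢x refl =
  trans (occ-++ c (replicate p _) w') (cong (_+ occ c w') (occ-replicate-miss p c≢x))

length-block : {x : Fin k} {p : ℕ} {w : Word k} (w' : Word k) → w ≡ replicate p x ++ w' → length w ≡ p + length w'
length-block {x = x} {p} w' refl =
  trans (length-++ (replicate p x)) (cong (_+ length w') (length-replicate p))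

-- The non-weakly-regular predicate behind parts (a), (c) and (e).

a b : Fin 2
a = zero
b = suc zero

Balanced : Predicate 2 2
Balanced w = occ a (lookup w zero) ≡ length (lookup w (suc zero))
           × occ b (lookup w zero) ≡ length (lookup w (suc zero))

absorbed : (p x N : ℕ) → N ≡ p + x → x ≡ N → p ≡ 0
absorbed p x N N≡p+x x≡N = +-cancelʳ-≡ N p 0 (trans (cong (p +_) (sym x≡N)) (sym N≡p+x))

-- Balanced is not weakly regular: an automaton with m states accepting the
-- balanced pair (aᵐbᵐ, aᵐ) would, by pumping down, also accept a pair
-- (y', z') with aᵐbᵐ = aᵖ⁰y' and aᵐ = aᵖ¹z', p₀ + p₁ > 0; but then
-- #b(y') = m forces |z'| = m and #a(y') = m, so p₀ = p₁ = 0.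
balanced-not-weakly-regular : ¬ WeaklyRegular Balanced
balanced-not-weakly-regular (M , recognises) = <-irrefl refl (subst (0 <_) (all-zero i) positive)
  where
  N : ℕ
  N = SAA.m M
  y : Word 2
  y = replicate N a ++ replicate N b
  witness : Vec (Word 2) 2
  witness = y ∷ replicate N a ∷ []
  occ-a-y : occ a y ≡ N
  occ-a-y = trans (occ-block-hit {p = N} (replicate N b) refl)
                  (trans (cong (N +_) (occ-replicate-miss N (λ ()))) (+-identityʳ N))
  occ-b-y : occ b y ≡ N
  occ-b-y = trans (occ-block-miss {p = N} (replicate N b) (λ ()) refl) (occ-replicate-hit b N)
  witness-balanced : Balanced witness
  witness-balanced = trans occ-a-y (sym (length-replicate N)) , trans occ-b-y (sym (length-replicate N))
  begins-with-a : ∀ i → Σ (Word 2) λ v → lookup witness i ≡ replicate N a ++ v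
  begins-with-a zero = replicate N b , refl
  begins-with-a (suc zero) = [] , sym (++-identityʳ (replicate N a))
  open PumpedDown (pump-down M a witness begins-with-a (Equivalence.to (recognises witness) witness-balanced))
  p : Fin 2 → ℕ
  p = deleted
  i : Fin 2
  i = proj₁ shrinks
  positive : 0 < p i
  positive = proj₂ shrinks
  y' z' : Word 2
  y' = lookup smaller zero
  z' = lookup smaller (suc zero)
  smaller-balanced : Balanced smaller
  smaller-balanced = Equivalence.from (recognises smaller) accepted
  count-a : N ≡ p zero + occ a y'
  count-a = trans (sym occ-a-y) (occ-block-hit y' (shifted zero))
  count-b : N ≡ occ b y'
  count-b = trans (sym occ-b-y) (occ-block-miss y' (λ ()) (shifted zero))
  count-z : N ≡ p (suc zero) + length z'
  count-z = trans (sym (length-replicate N)) (length-block z' (shifted (suc zero)))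
  z'-length : length z' ≡ N
  z'-length = trans (sym (proj₂ smaller-balanced)) (sym count-b)
  all-zero : ∀ i → p i ≡ 0
  all-zero zero = absorbed (p zero) (occ a y') N count-a (trans (proj₁ smaller-balanced) z'-length)
  all-zero (suc zero) = absorbed (p (suc zero)) (length z') N count-z z'-length

-- Soundness of automata: backward invariants.

record BackwardInvariant {k n : ℕ} (M : SAA k n) : Set₁ where
  open SAA M using (m; accept; part) renaming (trans to δ)
  field
    Inv        : Fin m → Trace k n → Set
    at-accept  : ∀ {r} → T (accept r) → Inv r []
    along-ε    : ∀ {q q' t} → T (δ q nothing q') → Inv q' t → Inv q t
    along-step : ∀ {q q' t} (a : Letter k) → T (δ q (just a) q') → Inv q' t → Inv q ((part q , a) ∷ t)

invariant-holds : {M : SAA k n} (I : BackwardInvariant M) {q r : Fin (SAA.m M)} {t : Trace k n} →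
                  Run M q r t → T (SAA.accept M r) → BackwardInvariant.Inv I q t
invariant-holds I stop r-accept = BackwardInvariant.at-accept I r-accept
invariant-holds I (stepε e ρ) r-accept = BackwardInvariant.along-ε I e (invariant-holds I ρ r-accept)
invariant-holds I (step a e ρ) r-accept = BackwardInvariant.along-step I a e (invariant-holds I ρ r-accept)

tape : Fin n → Trace k n → Word k
tape i t = catMaybes (project i t)

tape-of : {t : Trace k n} {w : Word k} (i : Fin n) → project i t ≡ spell w → tape i t ≡ w
tape-of {w = w} i spells = trans (cong catMaybes spells) (letters w)
  where
  letters : (w : Word k) → catMaybes (spell w) ≡ w
  letters [] = refl
  letters (x ∷ w) = cong (x ∷_) (letters w)

-- Completeness of automata: runs with prescribed projections.

record SpelledRun {k n : ℕ} (M : SAA k n) (q r : Fin (SAA.m M)) (L : Vec (List (Letter k)) n) : Set where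
  constructor spelledRun
  field
    {trace} : Trace k n
    run     : Run M q r trace
    spells  : ∀ i → project i trace ≡ lookup L i

ended : {M : SAA k n} {r : Fin (SAA.m M)} → SpelledRun M r r (Data.Vec.replicate n [])
ended {n = n} = spelledRun stop λ i → sym (lookup-replicate i [])

extend : {M : SAA k n} {q q' r : Fin (SAA.m M)} {L : Vec (List (Letter k)) n} (a : Letter k) →
         T (SAA.trans M q (just a) q') → SpelledRun M q' r L → SpelledRun M q r (L [ SAA.part M q ]%= (a ∷_))
extend {M = M} {q} {L = L} a e (spelledRun {t} ρ spells) = spelledRun (step a e ρ) λ i → by-sort i (SAA.part M q ≟ i)
  where
  by-sort : ∀ i → Dec (SAA.part M q ≡ i) →
            project i ((SAA.part M q , a) ∷ t) ≡ lookup (L [ SAA.part M q ]%= (a ∷_)) i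
  by-sort i (yes refl) = trans (project-here i a t) (trans (cong (a ∷_) (spells i)) (sym (lookup∘updateAt i L)))
  by-sort i (no j≢i) =
    trans (project-miss a t j≢i) (trans (spells i) (sym (lookup∘updateAt′ i _ (λ i≡j → j≢i (sym i≡j)) L)))

accepting : {M : SAA k n} {q r : Fin (SAA.m M)} {w : Vec (Word k) n} → T (SAA.start M q) → T (SAA.accept M r) →
            SpelledRun M q r (Data.Vec.map spell w) → Accepts M w
accepting {q = q} {r} {w} q-start r-accept (spelledRun ρ spells) =
  q , r , _ , q-start , r-accept , ρ , λ i → trans (spells i) (lookup-map i spell w)

module ListAutomaton {k n : ℕ} (m : ℕ) (start accept : Fin m → Bool)
                     (next : Fin m → Letter k → List (Fin m)) (part : Fin m → Fin n) where

  transitions : Fin m → Maybe (Letter k) → Fin m → Bool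
  transitions q nothing q' = false
  transitions q (just a) q' = isYes (any? (q' ≟_) (next q a))

  automaton : SAA k n
  automaton = record { m = m ; start = start ; accept = accept ; trans = transitions ; part = part }

  _⟨_⟩∷_ : {q q' r : Fin m} {L : Vec (List (Letter k)) n} (a : Letter k) → q' ∈ next q a →
           SpelledRun automaton q' r L → SpelledRun automaton q r (L [ part q ]%= (a ∷_))
  a ⟨ listed ⟩∷ R = extend a (fromWitness listed) R

  list-invariant : (Inv : Fin m → Trace k n → Set) → (∀ {r} → T (accept r) → Inv r []) →
                   (∀ {q q' t} (a : Letter k) → q' ∈ next q a → Inv q' t → Inv q ((part q , a) ∷ t)) →
                   BackwardInvariant automaton
  list-invariant Inv at-accept along-listed = record
    { Inv = Inv ; at-accept = at-accept ; along-ε = λ () ; along-step = λ a e → along-listed a (toWitness e) }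

Unbalanced : Fin k → Predicate k 2
Unbalanced c w = occ c (lookup w zero) ≢ length (lookup w (suc zero))

module UnbalancedAutomaton {k : ℕ} (c : Fin k) where

  -- States, with the tape they read: y (sort 0) or z (sort 1).
  pattern scan   = zero                                   -- y: match each c of y with a letter of z
  pattern pair   = suc zero                               -- z: the letter matching a c
  pattern z-left = suc (suc zero)                         -- z: y is exhausted; z must have a letter left
  pattern z-rest = suc (suc (suc zero))                   -- z: skip the rest of z
  pattern y-rest = suc (suc (suc (suc zero)))             -- y: a c with no partner in z; skip the rest of y
  pattern z-over = suc (suc (suc (suc (suc zero))))       -- z: z must be exhausted
  pattern done   = suc (suc (suc (suc (suc (suc zero)))))

  next : Fin 7 → Letter k → List (Fin 7)
  next scan nothing = [ z-left ]
  next scan (just x) = if does (c ≟ x) then pair ∷ y-rest ∷ [] else [ scan ]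
  next pair (just _) = [ scan ]
  next z-left (just _) = [ z-rest ]
  next z-rest (just _) = [ z-rest ]
  next z-rest nothing = [ done ]
  next y-rest (just _) = [ y-rest ]
  next y-rest nothing = [ z-over ]
  next z-over nothing = [ done ]
  next _ _ = []

  sort : Fin 7 → Fin 2
  sort pair = suc zero
  sort z-left = suc zero
  sort z-rest = suc zero
  sort z-over = suc zero
  sort _ = zero

  is-scan is-done : Fin 7 → Bool
  is-scan q = isYes (q ≟ scan)
  is-done q = isYes (q ≟ done)

  open ListAutomaton 7 is-scan is-done next sort public

  on-c : {x : Fin k} → c ≡ x → pair ∈ next scan (just x) × y-rest ∈ next scan (just x)
  on-c {x} refl with c ≟ c
  ... | yes _ = here refl , there (here refl)
  ... | no c≢c = ⊥-elim (c≢c refl)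

  off-c : {x : Fin k} → c ≢ x → scan ∈ next scan (just x)
  off-c {x} c≢x with c ≟ x
  ... | yes c≡x = ⊥-elim (c≢x c≡x)
  ... | no _ = here refl

  -- What the rest of an accepting trace writes, seen from each state.
  Inv : Fin 7 → Trace k 2 → Set
  Inv scan t   = occ c (tape zero t) ≢ length (tape (suc zero) t)
  Inv pair t   = suc (occ c (tape zero t)) ≢ length (tape (suc zero) t)
  Inv z-left t = occ c (tape zero t) ≡ 0 × 0 < length (tape (suc zero) t)
  Inv z-rest t = occ c (tape zero t) ≡ 0
  Inv y-rest t = length (tape (suc zero) t) ≡ 0
  Inv z-over t = occ c (tape zero t) ≡ 0 × length (tape (suc zero) t) ≡ 0
  Inv done t   = occ c (tape zero t) ≡ 0 × length (tape (suc zero) t) ≡ 0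

  scan-letter : {x : Fin k} {q' : Fin 7} {t : Trace k 2} (d : Dec (c ≡ x)) →
                q' ∈ (if does d then pair ∷ y-rest ∷ [] else [ scan ]) → Inv q' t →
                Inv scan ((zero , just x) ∷ t)
  scan-letter {t = t} (yes refl) (here refl) unmatched = λ e → unmatched (trans (sym (occ-hit c (tape zero t))) e)
  scan-letter {t = t} (yes refl) (there (here refl)) z-empty =
    λ e → 1+n≢0 (trans (sym (occ-hit c (tape zero t))) (trans e z-empty))
  scan-letter {t = t} (no c≢x) (here refl) unmatched = λ e → unmatched (trans (sym (occ-miss (tape zero t) c≢x)) e)

  preserved : ∀ {q q' t} (a : Letter k) → q' ∈ next q a → Inv q' t → Inv q ((sort q , a) ∷ t)
  preserved {scan} nothing (here refl) (no-c , z-nonempty) = λ e → <⇒≢ z-nonempty (trans (sym no-c) e)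
  preserved {scan} (just x) mem inv = scan-letter (c ≟ x) mem inv
  preserved {pair} (just x) (here refl) unbalanced = λ e → unbalanced (suc-injective e)
  preserved {z-left} (just x) (here refl) no-c = no-c , s≤s z≤n
  preserved {z-rest} (just x) (here refl) no-c = no-c
  preserved {z-rest} nothing (here refl) (no-c , _) = no-c
  preserved {y-rest} (just x) (here refl) z-empty = z-empty
  preserved {y-rest} nothing (here refl) (_ , z-empty) = z-empty
  preserved {z-over} nothing (here refl) both = both

  finished : ∀ {r} → T (is-done r) → Inv r []
  finished r-done with toWitness r-done
  ... | refl = refl , refl

  sound : (w : Vec (Word k) 2) → Accepts automaton w → Unbalanced c w
  sound w (q , r , t , q-start , r-done , ρ , spells) with toWitness q-start
  ... | refl = subst₂ (λ y z → occ c y ≢ length z)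
                 (tape-of {t = t} zero (spells zero)) (tape-of {t = t} (suc zero) (spells (suc zero)))
                 (invariant-holds (list-invariant Inv finished preserved) ρ r-done)

  read-z-rest : (z : Word k) → SpelledRun automaton z-rest done ([] ∷ spell z ∷ [])
  read-z-rest [] = nothing ⟨ here refl ⟩∷ ended
  read-z-rest (x ∷ z) = just x ⟨ here refl ⟩∷ read-z-rest z

  read-y-rest : (y : Word k) → SpelledRun automaton y-rest done (spell y ∷ spell [] ∷ [])
  read-y-rest [] = nothing ⟨ here refl ⟩∷ (nothing ⟨ here refl ⟩∷ ended)
  read-y-rest (x ∷ y) = just x ⟨ here refl ⟩∷ read-y-rest y

  -- Match the c's of y with letters of z until one of the two runs out; after
  -- the case split on c ≟ x the count #c(x ∷ y) computes.
  complete : (y z : Word k) → occ c y ≢ length z → SpelledRun automaton scan done (spell y ∷ spell z ∷ [])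
  complete [] [] unbalanced = ⊥-elim (unbalanced refl)
  complete [] (x ∷ z) _ = nothing ⟨ here refl ⟩∷ (just x ⟨ here refl ⟩∷ read-z-rest z)
  complete (x ∷ y) z unbalanced with c ≟ x
  complete (x ∷ y) [] unbalanced | yes refl = just c ⟨ proj₂ (on-c refl) ⟩∷ read-y-rest y
  complete (x ∷ y) (l ∷ z) unbalanced | yes refl =
    just c ⟨ proj₁ (on-c refl) ⟩∷ (just l ⟨ here refl ⟩∷
      complete y z (λ e → unbalanced (cong suc e)))
  ... | no c≢x = just x ⟨ off-c c≢x ⟩∷ complete y z unbalanced

unbalanced-weakly-regular : (c : Fin k) → WeaklyRegular (Unbalanced c)
unbalanced-weakly-regular c =
  automaton , λ { w@(y ∷ z ∷ []) → mk⇔ (λ ne → accepting tt tt (complete y z ne)) (sound w) }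
  where open UnbalancedAutomaton c

Mode : Bool → Word k → Set
Mode true u = u ≡ []
Mode false u = u ≢ []

Guarded : Bool → Fin k → Predicate k 3
Guarded md c w = Mode md (lookup w zero) × occ c (lookup w (suc zero)) ≡ length (lookup w (suc (suc zero)))

module GuardedAutomaton {k : ℕ} (c : Fin k) where

  -- States, with the tape they read: u (sort 0), y (sort 1) or z (sort 2).
  pattern u-empty    = zero                                   -- u: u must be empty
  pattern u-nonempty = suc zero                               -- u: u must have a letter
  pattern u-rest     = suc (suc zero)                         -- u: skip the rest of u
  pattern count      = suc (suc (suc zero))                   -- y: match each c of y with a letter of z
  pattern pair       = suc (suc (suc (suc zero)))             -- z: the letter matching a c
  pattern z-end      = suc (suc (suc (suc (suc zero))))       -- z: z must be exhausted
  pattern done       = suc (suc (suc (suc (suc (suc zero)))))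

  next : Fin 7 → Letter k → List (Fin 7)
  next u-empty nothing = [ count ]
  next u-nonempty (just _) = [ u-rest ]
  next u-rest (just _) = [ u-rest ]
  next u-rest nothing = [ count ]
  next count nothing = [ z-end ]
  next count (just x) = if does (c ≟ x) then [ pair ] else [ count ]
  next pair (just _) = [ count ]
  next z-end nothing = [ done ]
  next _ _ = []

  sort : Fin 7 → Fin 3
  sort count = suc zero
  sort pair = suc (suc zero)
  sort z-end = suc (suc zero)
  sort _ = zero

  begin : Bool → Fin 7
  begin true = u-empty
  begin false = u-nonempty

  start : Bool → Fin 7 → Bool
  start md q = isYes (q ≟ begin md)

  is-done : Fin 7 → Bool
  is-done q = isYes (q ≟ done)

  automaton : Bool → SAA k 3
  automaton md = ListAutomaton.automaton 7 (start md) is-done next sort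

  on-c : {x : Fin k} → c ≡ x → pair ∈ next count (just x)
  on-c {x} refl with c ≟ c
  ... | yes _ = here refl
  ... | no c≢c = ⊥-elim (c≢c refl)

  off-c : {x : Fin k} → c ≢ x → count ∈ next count (just x)
  off-c {x} c≢x with c ≟ x
  ... | yes c≡x = ⊥-elim (c≢x c≡x)
  ... | no _ = here refl

  -- What the rest of an accepting trace writes, seen from each state.
  Counted Settled : Trace k 3 → Set
  Counted t = occ c (tape (suc zero) t) ≡ length (tape (suc (suc zero)) t)
  Settled t = tape zero t ≡ [] × Counted t

  Inv : Fin 7 → Trace k 3 → Set
  Inv u-empty t    = Settled t
  Inv u-nonempty t = tape zero t ≢ [] × Counted t
  Inv u-rest t     = Counted t
  Inv count t      = Settled t
  Inv pair t       = tape zero t ≡ [] × suc (occ c (tape (suc zero) t)) ≡ length (tape (suc (suc zero)) t)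
  Inv z-end t      = Settled t
  Inv done t       = Settled t

  count-letter : {x : Fin k} {q' : Fin 7} {t : Trace k 3} (d : Dec (c ≡ x)) →
                 q' ∈ (if does d then [ pair ] else [ count ]) → Inv q' t → Inv count ((suc zero , just x) ∷ t)
  count-letter {t = t} (yes refl) (here refl) (u-done , matched) = u-done , trans (occ-hit c (tape (suc zero) t)) matched
  count-letter {t = t} (no c≢x) (here refl) (u-done , counted) =
    u-done , trans (occ-miss (tape (suc zero) t) c≢x) counted

  preserved : ∀ {q q' t} (a : Letter k) → q' ∈ next q a → Inv q' t → Inv q ((sort q , a) ∷ t)
  preserved {u-empty} nothing (here refl) settled = settled
  preserved {u-nonempty} (just x) (here refl) counted = (λ ()) , counted
  preserved {u-rest} (just x) (here refl) counted = counted
  preserved {u-rest} nothing (here refl) (_ , counted) = counted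
  preserved {count} nothing (here refl) settled = settled
  preserved {count} (just x) mem inv = count-letter (c ≟ x) mem inv
  preserved {pair} (just x) (here refl) (u-done , counted) = u-done , cong suc counted
  preserved {z-end} nothing (here refl) settled = settled

  finished : ∀ {r} → T (is-done r) → Inv r []
  finished r-done with toWitness r-done
  ... | refl = refl , refl

  at-begin : (md : Bool) {q : Fin 7} {t : Trace k 3} → q ≡ begin md → Inv q t → Mode md (tape zero t) × Counted t
  at-begin true refl inv = inv
  at-begin false refl inv = inv

  sound : (md : Bool) (w : Vec (Word k) 3) → Accepts (automaton md) w → Guarded md c w
  sound md (u ∷ y ∷ z ∷ []) (q , r , t , q-start , r-done , ρ , spells)
    with tape-of {t = t} zero (spells zero) | tape-of {t = t} (suc zero) (spells (suc zero))
       | tape-of {t = t} (suc (suc zero)) (spells (suc (suc zero)))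
  ... | refl | refl | refl =
    at-begin md (toWitness q-start) (invariant-holds (list-invariant Inv finished preserved) ρ r-done)
    where open ListAutomaton 7 (start md) is-done next sort using (list-invariant)

  module Runs (md : Bool) where
    open ListAutomaton 7 (start md) is-done next sort using (_⟨_⟩∷_) public

    count-run : (y z : Word k) → occ c y ≡ length z →
                SpelledRun (automaton md) count done ([] ∷ spell y ∷ spell z ∷ [])
    count-run [] [] _ = nothing ⟨ here refl ⟩∷ (nothing ⟨ here refl ⟩∷ ended)
    count-run (x ∷ y) z counted with c ≟ x
    count-run (x ∷ y) (l ∷ z) counted | yes refl =
      just c ⟨ on-c refl ⟩∷ (just l ⟨ here refl ⟩∷ count-run y z (suc-injective counted))
    ... | no c≢x = just x ⟨ off-c c≢x ⟩∷ count-run y z counted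

    u-rest-run : (u y z : Word k) → occ c y ≡ length z →
                 SpelledRun (automaton md) u-rest done (spell u ∷ spell y ∷ spell z ∷ [])
    u-rest-run [] y z counted = nothing ⟨ here refl ⟩∷ count-run y z counted
    u-rest-run (x ∷ u) y z counted = just x ⟨ here refl ⟩∷ u-rest-run u y z counted

  complete : (md : Bool) (w : Vec (Word k) 3) → Guarded md c w → Accepts (automaton md) w
  complete true ([] ∷ y ∷ z ∷ []) (refl , counted) =
    accepting {q = u-empty} tt tt (nothing ⟨ here refl ⟩∷ count-run y z counted)
    where open Runs true
  complete false ([] ∷ y ∷ z ∷ []) (nonempty , _) = ⊥-elim (nonempty refl)
  complete false ((x ∷ u) ∷ y ∷ z ∷ []) (_ , counted) =
    accepting {q = u-nonempty} tt tt (just x ⟨ here refl ⟩∷ u-rest-run u y z counted)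
    where open Runs false

guarded-weakly-regular : (md : Bool) (c : Fin k) → WeaklyRegular (Guarded md c)
guarded-weakly-regular md c = automaton md , λ w → mk⇔ (complete md w) (sound md w)
  where open GuardedAutomaton c

-- Automata on a disjoint union of state sets.

AcceptingFrom : (M : SAA k n) → Fin (SAA.m M) → Trace k n → Set
AcceptingFrom M q t = Σ (Fin (SAA.m M)) λ r → T (SAA.accept M r) × Run M q r t

-- An automaton whose states are Fin m₁ ⊎ Fin m₂; it is turned into an SAA by
-- the encoding of Fin m₁ ⊎ Fin m₂ as Fin (m₁ + m₂).
record Automaton⊎ (k n m₁ m₂ : ℕ) : Set where
  field
    start accept : Fin m₁ ⊎ Fin m₂ → Bool
    δ            : Fin m₁ ⊎ Fin m₂ → Maybe (Letter k) → Fin m₁ ⊎ Fin m₂ → Bool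
    part         : Fin m₁ ⊎ Fin m₂ → Fin n

module Encoded {k n m₁ m₂ : ℕ} (A : Automaton⊎ k n m₁ m₂) where
  open Automaton⊎ A

  decode : Fin (m₁ + m₂) → Fin m₁ ⊎ Fin m₂
  decode = splitAt m₁

  encode : Fin m₁ ⊎ Fin m₂ → Fin (m₁ + m₂)
  encode = join m₁ m₂

  saa : SAA k n
  saa = record { m = m₁ + m₂
               ; start = λ q → start (decode q) ; accept = λ q → accept (decode q)
               ; trans = λ q a q' → δ (decode q) a (decode q') ; part = λ q → part (decode q) }

  encoded : ∀ {s s' : Fin m₁ ⊎ Fin m₂} {a} → T (δ s a s') → T (SAA.trans saa (encode s) a (encode s'))
  encoded {s} {s'} {a} = subst T (sym (cong₂ (λ x y → δ x a y) (splitAt-join m₁ m₂ s) (splitAt-join m₁ m₂ s')))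

  stepε⊎ : ∀ {s s' r t} → T (δ s nothing s') → Run saa (encode s') r t → Run saa (encode s) r t
  stepε⊎ e ρ = stepε (encoded e) ρ

  step⊎ : ∀ {s s' r t} (a : Letter k) → T (δ s (just a) s') → Run saa (encode s') r t →
          Run saa (encode s) r ((part s , a) ∷ t)
  step⊎ {s} {r = r} {t} a e ρ =
    subst (λ j → Run saa (encode s) r ((j , a) ∷ t)) (cong part (splitAt-join m₁ m₂ s)) (step a (encoded e) ρ)

  accepts⊎ : ∀ {s s' t} {w : Vec (Word k) n} → T (start s) → T (accept s') → Run saa (encode s) (encode s') t →
             (∀ i → project i t ≡ spell (lookup w i)) → Accepts saa w
  accepts⊎ {s} {s'} {t} s-start s'-accept ρ spells =
    encode s , encode s' , t , subst T (sym (cong start (splitAt-join m₁ m₂ s))) s-start ,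
    subst T (sym (cong accept (splitAt-join m₁ m₂ s'))) s'-accept , ρ , spells

  simulate : {M : SAA k n} (f : Fin (SAA.m M) → Fin m₁ ⊎ Fin m₂) →
             (∀ {q a q'} → T (SAA.trans M q a q') → T (δ (f q) a (f q'))) → (∀ q → part (f q) ≡ SAA.part M q) →
             ∀ {q r t} → Run M q r t → Run saa (encode (f q)) (encode (f r)) t
  simulate f along sorts stop = stop
  simulate f along sorts (stepε e ρ) = stepε⊎ (along e) (simulate f along sorts ρ)
  simulate f along sorts {q} (step {t = t} a e ρ) =
    subst (λ j → Run saa _ _ ((j , a) ∷ t)) (sorts q) (step⊎ a (along e) (simulate f along sorts ρ))

  invariant⊎ : (Inv : Fin m₁ ⊎ Fin m₂ → Trace k n → Set) →
               (∀ {s} → T (accept s) → Inv s []) →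
               (∀ {s s' t} → T (δ s nothing s') → Inv s' t → Inv s t) →
               (∀ {s s' t} (a : Letter k) → T (δ s (just a) s') → Inv s' t → Inv s ((part s , a) ∷ t)) →
               BackwardInvariant saa
  invariant⊎ Inv at-accept along-ε along-step = record
    { Inv = λ q → Inv (decode q) ; at-accept = at-accept ; along-ε = along-ε ; along-step = along-step }

module Union {k n : ℕ} (M₁ M₂ : SAA k n) where
  open SAA M₁ using () renaming (m to m₁; start to start₁; accept to accept₁; trans to δ₁; part to part₁)
  open SAA M₂ using () renaming (m to m₂; start to start₂; accept to accept₂; trans to δ₂; part to part₂)

  transitions : Fin m₁ ⊎ Fin m₂ → Maybe (Letter k) → Fin m₁ ⊎ Fin m₂ → Bool
  transitions (inj₁ q) a (inj₁ q') = δ₁ q a q'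
  transitions (inj₂ q) a (inj₂ q') = δ₂ q a q'
  transitions _ _ _ = false

  union : Automaton⊎ k n m₁ m₂
  union = record { start = [ start₁ , start₂ ]′ ; accept = [ accept₁ , accept₂ ]′
                 ; δ = transitions ; part = [ part₁ , part₂ ]′ }

  open Encoded union

  -- Soundness: the rest of an accepting run of the union is produced by an
  -- accepting run of the component its current state belongs to.
  Inv : Fin m₁ ⊎ Fin m₂ → Trace k n → Set
  Inv (inj₁ q) t = AcceptingFrom M₁ q t
  Inv (inj₂ q) t = AcceptingFrom M₂ q t

  at-accept : ∀ {s} → T (Automaton⊎.accept union s) → Inv s []
  at-accept {inj₁ r} r-accept = r , r-accept , stop
  at-accept {inj₂ r} r-accept = r , r-accept , stop

  along-ε : ∀ {s s' t} → T (transitions s nothing s') → Inv s' t → Inv s t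
  along-ε {inj₁ _} {inj₁ _} e (r , r-accept , ρ) = r , r-accept , stepε e ρ
  along-ε {inj₂ _} {inj₂ _} e (r , r-accept , ρ) = r , r-accept , stepε e ρ

  along-step : ∀ {s s' t} (a : Letter k) → T (transitions s (just a) s') → Inv s' t →
               Inv s ((Automaton⊎.part union s , a) ∷ t)
  along-step {inj₁ _} {inj₁ _} a e (r , r-accept , ρ) = r , r-accept , step a e ρ
  along-step {inj₂ _} {inj₂ _} a e (r , r-accept , ρ) = r , r-accept , step a e ρ

  sound : (w : Vec (Word k) n) → Accepts saa w → Accepts M₁ w ⊎ Accepts M₂ w
  sound w (q , _ , t , q-start , r-accept , ρ , spells) =
    started (decode q) q-start (invariant-holds (invariant⊎ Inv at-accept along-ε along-step) ρ r-accept)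
    where
    started : ∀ s → T (Automaton⊎.start union s) → Inv s t → Accepts M₁ w ⊎ Accepts M₂ w
    started (inj₁ q₁) q-start (r , r-accept , ρ) = inj₁ (q₁ , r , t , q-start , r-accept , ρ , spells)
    started (inj₂ q₂) q-start (r , r-accept , ρ) = inj₂ (q₂ , r , t , q-start , r-accept , ρ , spells)

  complete : (w : Vec (Word k) n) → Accepts M₁ w ⊎ Accepts M₂ w → Accepts saa w
  complete w (inj₁ (q , r , t , q-start , r-accept , ρ , spells)) =
    accepts⊎ {inj₁ q} {inj₁ r} {w = w} q-start r-accept (simulate inj₁ (λ e → e) (λ _ → refl) ρ) spells
  complete w (inj₂ (q , r , t , q-start , r-accept , ρ , spells)) =
    accepts⊎ {inj₂ q} {inj₂ r} {w = w} q-start r-accept (simulate inj₂ (λ e → e) (λ _ → refl) ρ) spells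

or-weakly-regular : {P Q : Predicate k n} → WeaklyRegular P → WeaklyRegular Q → WeaklyRegular (Or P Q)
or-weakly-regular (M₁ , recognises₁) (M₂ , recognises₂) = saa , λ w → mk⇔
  (λ P∨Q → complete w (Data.Sum.map (Equivalence.to (recognises₁ w)) (Equivalence.to (recognises₂ w)) P∨Q))
  (λ acc → Data.Sum.map (Equivalence.from (recognises₁ w)) (Equivalence.from (recognises₂ w)) (sound w acc))
  where
  open Union M₁ M₂
  open Encoded union

-- The automaton E runs M and
-- guesses x₁: the steps of M on the first tape become ε-moves.  Its states
-- are those of M in two phases, inj₁ while x₁ is being guessed and inj₂ once
-- the end marker of x₁ has been passed.
module Existential {k n : ℕ} (M : SAA k (suc (suc n))) where
  open SAA M using (m; start; accept; part) renaming (trans to δ)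

  first? : Fin (suc (suc n)) → Bool
  first? zero = true
  first? (suc _) = false

  lower : Fin (suc (suc n)) → Fin (suc n)
  lower zero = zero
  lower (suc j) = j

  guessable : Fin m → Fin m → Bool
  guessable q q' = isYes (anyFin? λ c → T? (δ q (just (just c)) q'))

  guessed : ∀ {q q'} → T (guessable q q') → ∃ λ c → T (δ q (just (just c)) q')
  guessed {q} {q'} = toWitness {a? = anyFin? λ c → T? (δ q (just (just c)) q')}

  guess : ∀ {q q'} (c : Fin k) → T (δ q (just (just c)) q') → T (guessable q q')
  guess {q} {q'} c e = fromWitness {a? = anyFin? λ c → T? (δ q (just (just c)) q')} (c , e)

  state : Fin m ⊎ Fin m → Fin m
  state (inj₁ q) = q
  state (inj₂ q) = q

  transitions : Fin m ⊎ Fin m → Maybe (Letter k) → Fin m ⊎ Fin m → Bool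
  transitions (inj₁ q) nothing (inj₁ q') = δ q nothing q' ∨ (first? (part q) ∧ guessable q q')
  transitions (inj₁ q) nothing (inj₂ q') = first? (part q) ∧ δ q (just nothing) q'
  transitions (inj₂ q) nothing (inj₂ q') = δ q nothing q'
  transitions (inj₁ q) (just a) (inj₁ q') = not (first? (part q)) ∧ δ q (just a) q'
  transitions (inj₂ q) (just a) (inj₂ q') = not (first? (part q)) ∧ δ q (just a) q'
  transitions _ _ _ = false

  E : Automaton⊎ k (suc n) m m
  E = record { start = [ start , (λ _ → false) ]′ ; accept = [ (λ _ → false) , accept ]′
             ; δ = transitions ; part = λ s → lower (part (state s)) }

  open Encoded E

  guessing : Fin m ⊎ Fin m → Bool
  guessing (inj₁ _) = true
  guessing (inj₂ _) = false

  Remaining : Bool → List (Letter k) → Set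
  Remaining true L = Σ (Word k) λ x → L ≡ spell x
  Remaining false L = L ≡ []

  Erases : Trace k (suc n) → Trace k (suc (suc n)) → Set
  Erases t' t = ∀ i → project i t' ≡ project (suc i) t

  erase-later : ∀ (j : Fin (suc n)) (a : Letter k) {t' t} → Erases t' t → Erases ((j , a) ∷ t') ((suc j , a) ∷ t)
  erase-later j a erases i with j ≟ i
  ... | yes refl = cong (a ∷_) (erases i)
  ... | no _ = erases i

  first-step : ∀ {q q' r t} (a : Letter k) → T (first? (part q)) → T (δ q (just a) q') → Run M q' r t →
               Run M q r ((zero , a) ∷ t)
  first-step {q} a first e ρ = subst (λ j → Run M q _ ((j , a) ∷ _)) (is-first (part q) first) (step a e ρ)
    where
    is-first : ∀ j → T (first? j) → j ≡ zero
    is-first zero _ = refl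

  later-step : ∀ {q q' r t} (a : Letter k) → T (not (first? (part q)) ∧ δ q (just a) q') → Run M q' r t →
               Run M q r ((suc (lower (part q)) , a) ∷ t)
  later-step {q} {q'} a e ρ =
    subst (λ j → Run M q _ ((j , a) ∷ _)) (is-later (part q) (proj₁ later∧e)) (step a (proj₂ later∧e) ρ)
    where
    later∧e : T (not (first? (part q))) × T (δ q (just a) q')
    later∧e = Equivalence.to T-∧ e
    is-later : ∀ j → T (not (first? j)) → j ≡ suc (lower j)
    is-later (suc j) _ = refl

  -- Soundness: the rest of an accepting run of E from s is the erasure of the
  -- rest of an accepting run of M from the same state.
  Lifts : Fin m ⊎ Fin m → Trace k (suc n) → Set
  Lifts s t' = Σ (Trace k (suc (suc n))) λ t →
    AcceptingFrom M (state s) t × Erases t' t × Remaining (guessing s) (project zero t)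

  at-accept : ∀ {s} → T (Automaton⊎.accept E s) → Lifts s []
  at-accept {inj₂ r} r-accept = [] , (r , r-accept , stop) , (λ i → refl) , refl

  -- Guessing a letter c of x₁ is a step of M on the first tape labelled c.
  guess-letter : ∀ {q q' t'} → T (first? (part q) ∧ guessable q q') → Lifts (inj₁ q') t' → Lifts (inj₁ q) t'
  guess-letter e (t , (r , r-accept , ρ) , erases , (x , first-tape))
    with Equivalence.to T-∧ e
  ... | first , guessable with guessed guessable
  ... | c , e' = (zero , just c) ∷ t , (r , r-accept , first-step (just c) first e' ρ) , erases ,
                 (c ∷ x , cong (just c ∷_) first-tape)

  -- Ending x₁ is a step of M on the first tape labelled $.
  end-x₁ : ∀ {q q' t'} → T (first? (part q) ∧ δ q (just nothing) q') → Lifts (inj₂ q') t' → Lifts (inj₁ q) t'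
  end-x₁ e (t , (r , r-accept , ρ) , erases , first-tape) with Equivalence.to T-∧ e
  ... | first , e' = (zero , nothing) ∷ t , (r , r-accept , first-step nothing first e' ρ) , erases ,
                     ([] , cong (nothing ∷_) first-tape)

  along-ε : ∀ {s s' t'} → T (transitions s nothing s') → Lifts s' t' → Lifts s t'
  along-ε {inj₁ q} {inj₁ q'} {t'} e lifts@(t , (r , r-accept , ρ) , erases , remaining) with Equivalence.to T-∨ e
  ... | inj₁ ε-move = t , (r , r-accept , stepε ε-move ρ) , erases , remaining
  ... | inj₂ guess = guess-letter {t' = t'} guess lifts
  along-ε {inj₁ q} {inj₂ q'} {t'} e lifts = end-x₁ {t' = t'} e lifts
  along-ε {inj₂ q} {inj₂ q'} e (t , (r , r-accept , ρ) , erases , remaining) =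
    t , (r , r-accept , stepε e ρ) , erases , remaining

  along-step : ∀ {s s' t'} (a : Letter k) → T (transitions s (just a) s') → Lifts s' t' →
               Lifts s ((Automaton⊎.part E s , a) ∷ t')
  along-step {inj₁ q} {inj₁ q'} a e (t , (r , r-accept , ρ) , erases , remaining) =
    (suc (lower (part q)) , a) ∷ t , (r , r-accept , later-step a e ρ) , erase-later (lower (part q)) a erases , remaining
  along-step {inj₂ q} {inj₂ q'} a e (t , (r , r-accept , ρ) , erases , remaining) =
    (suc (lower (part q)) , a) ∷ t , (r , r-accept , later-step a e ρ) , erase-later (lower (part q)) a erases , remaining

  sound : (v : Vec (Word k) (suc n)) → Accepts saa v → Σ (Word k) λ x → Accepts M (x ∷ v)
  sound v (q , r , t' , q-start , r-accept , ρ , spells) =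
    started (decode q) q-start (invariant-holds invariant ρ r-accept)
    where
    invariant : BackwardInvariant saa
    invariant = invariant⊎ Lifts at-accept (λ {s} {s'} {t'} → along-ε {s} {s'} {t'}) along-step
    started : ∀ s → T (Automaton⊎.start E s) → Lifts s t' → Σ (Word k) λ x → Accepts M (x ∷ v)
    started (inj₁ q₀) q-start (t , (r₀ , r-accept , ρ₀) , erases , (x , first-tape)) =
      x , q₀ , r₀ , t , q-start , r-accept , ρ₀ ,
      λ { zero → first-tape ; (suc i) → trans (sym (erases i)) (spells i) }

  phase : Bool → Fin m → Fin m ⊎ Fin m
  phase true = inj₁
  phase false = inj₂

  state-phase : ∀ ph q → state (phase ph q) ≡ q
  state-phase true q = refl
  state-phase false q = refl

  ε-move : ∀ ph {q q'} → T (δ q nothing q') → T (transitions (phase ph q) nothing (phase ph q'))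
  ε-move true e = Equivalence.from T-∨ (inj₁ e)
  ε-move false e = e

  guess-move : ∀ {q q'} (c : Fin k) → part q ≡ zero → T (δ q (just (just c)) q') →
               T (transitions (inj₁ q) nothing (inj₁ q'))
  guess-move c first e =
    Equivalence.from T-∨ (inj₂ (Equivalence.from T-∧ (subst (T ∘ first?) (sym first) tt , guess c e)))

  end-move : ∀ {q q'} → part q ≡ zero → T (δ q (just nothing) q') → T (transitions (inj₁ q) nothing (inj₂ q'))
  end-move first e = Equivalence.from T-∧ (subst (T ∘ first?) (sym first) tt , e)

  later-move : ∀ ph {q q' j} {a : Letter k} → part q ≡ suc j → T (δ q (just a) q') →
               T (transitions (phase ph q) (just a) (phase ph q'))
  later-move true later e = Equivalence.from T-∧ (subst (T ∘ not ∘ first?) (sym later) tt , e)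
  later-move false later e = Equivalence.from T-∧ (subst (T ∘ not ∘ first?) (sym later) tt , e)

  Lifted : Fin m ⊎ Fin m → Fin m → Trace k (suc (suc n)) → Set
  Lifted s r t = Σ (Trace k (suc n)) λ t' → Run saa (encode s) (encode (inj₂ r)) t' × Erases t' t

  lift : ∀ (ph : Bool) {q r t} → Run M q r t → Remaining ph (project zero t) → Lifted (phase ph q) r t
  lift-step : ∀ (ph : Bool) {q q' r t} (j : Fin (suc (suc n))) → part q ≡ j → (a : Letter k) → T (δ q (just a) q') →
              Run M q' r t → Remaining ph (project zero ((j , a) ∷ t)) → Lifted (phase ph q) r ((j , a) ∷ t)

  lift false stop refl = [] , stop , λ i → refl
  lift true stop ([] , ())
  lift true stop (_ ∷ _ , ())
  lift ph {q} (stepε {q' = q'} e ρ) remaining with lift ph ρ remaining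
  ... | t' , ρ' , erases = t' , stepε⊎ {phase ph q} {phase ph q'} (ε-move ph e) ρ' , erases
  lift ph {q} (step a e ρ) remaining = lift-step ph (part q) refl a e ρ remaining

  -- A step of M on the first tape becomes an ε-move of E, guessing its letter
  -- or ending x₁; a step on a later tape becomes a step of E.
  lift-step false zero _ a e ρ ()
  lift-step true {q} {q'} zero first nothing e ρ ([] , first-tape) with lift false ρ (∷-injectiveʳ first-tape)
  ... | t' , ρ' , erases = t' , stepε⊎ {inj₁ q} {inj₂ q'} (end-move first e) ρ' , erases
  lift-step true zero first nothing e ρ (_ ∷ _ , ())
  lift-step true zero first (just c) e ρ ([] , ())
  lift-step true {q} {q'} zero first (just c) e ρ (_ ∷ x , first-tape) with lift true ρ (x , ∷-injectiveʳ first-tape)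
  ... | t' , ρ' , erases = t' , stepε⊎ {inj₁ q} {inj₁ q'} (guess-move c first e) ρ' , erases
  lift-step ph {q} {q'} {r} (suc j) later a e ρ remaining with lift ph ρ remaining
  ... | t' , ρ' , erases = (j , a) ∷ t' , later-run , erase-later j a erases
    where
    sort : lower (part (state (phase ph q))) ≡ j
    sort = trans (cong (lower ∘ part) (state-phase ph q)) (cong lower later)
    later-run : Run saa (encode (phase ph q)) (encode (inj₂ r)) ((j , a) ∷ t')
    later-run = subst (λ i → Run saa _ _ ((i , a) ∷ t')) sort
                  (step⊎ {phase ph q} {phase ph q'} a (later-move ph later e) ρ')

  complete : (v : Vec (Word k) (suc n)) → (Σ (Word k) λ x → Accepts M (x ∷ v)) → Accepts saa v
  complete v (x , q , r , t , q-start , r-accept , ρ , spells) with lift true ρ (x , spells zero)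
  ... | t' , ρ' , erases =
    accepts⊎ {inj₁ q} {inj₂ r} {w = v} q-start r-accept ρ' λ i → trans (erases i) (spells (suc i))

exists-weakly-regular : {P : Predicate k (suc (suc n))} → WeaklyRegular P → WeaklyRegular (Exists₁ P)
exists-weakly-regular (M , recognises) = saa , λ v → mk⇔
  (λ { (x , p) → complete v (x , Equivalence.to (recognises (x ∷ v)) p) })
  (λ acc → let (x , accepted) = sound v acc in x , Equivalence.from (recognises (x ∷ v)) accepted)
  where
  open Existential M
  open Encoded E

-- The three counterexamples are each equivalent to Balanced.

weaklyRegular-resp : {P Q : Predicate k n} → (∀ w → P w ⇔ Q w) → WeaklyRegular P → WeaklyRegular Q
weaklyRegular-resp P⇔Q (M , recognises) = M , λ w →
  mk⇔ (λ q → Equivalence.to (recognises w) (Equivalence.from (P⇔Q w) q))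
      (λ acc → Equivalence.to (P⇔Q w) (Equivalence.from (recognises w) acc))

not-weakly-regular : {P : Predicate 2 2} → (∀ w → P w ⇔ Balanced w) → ¬ WeaklyRegular P
not-weakly-regular P⇔Balanced = balanced-not-weakly-regular ∘ weaklyRegular-resp P⇔Balanced

-- (a) A pair is balanced iff it is neither a-unbalanced nor b-unbalanced
-- (the counts are decidable).
complement-balanced : ∀ w → Not (Or (Unbalanced a) (Unbalanced b)) w ⇔ Balanced w
complement-balanced w = mk⇔
  (λ neither → decidable-stable (_ ≟ℕ _) (neither ∘ inj₁) , decidable-stable (_ ≟ℕ _) (neither ∘ inj₂))
  (λ { (balanced-a , balanced-b) → [ (λ ne → ne balanced-a) , (λ ne → ne balanced-b) ]′ })

-- (c) Forgetting u, Guarded true c is the condition #c(y) = |z|.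
conjunction-balanced : ∀ w → And (Exists₁ (Guarded true a)) (Exists₁ (Guarded true b)) w ⇔ Balanced w
conjunction-balanced w = mk⇔
  (λ { ((_ , _ , balanced-a) , (_ , _ , balanced-b)) → balanced-a , balanced-b })
  (λ { (balanced-a , balanced-b) → ([] , refl , balanced-a) , ([] , refl , balanced-b) })

-- (e) For all u: u = [] forces the a-condition and u = a forces the b-condition.
universal-balanced : ∀ w → Forall₁ (Or (Guarded true a) (Guarded false b)) w ⇔ Balanced w
universal-balanced w = mk⇔
  (λ all-u → for-empty (all-u []) , for-nonempty (all-u [ a ]))
  (λ { (balanced-a , balanced-b) → λ { [] → inj₁ (refl , balanced-a) ; (_ ∷ _) → inj₂ ((λ ()) , balanced-b) } })
  where
  for-empty : Or (Guarded true a) (Guarded false b) ([] ∷ w) →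
              occ a (lookup w zero) ≡ length (lookup w (suc zero))
  for-empty (inj₁ (_ , balanced-a)) = balanced-a
  for-empty (inj₂ (nonempty , _)) = ⊥-elim (nonempty refl)
  for-nonempty : Or (Guarded true a) (Guarded false b) ([ a ] ∷ w) →
                 occ b (lookup w zero) ≡ length (lookup w (suc zero))
  for-nonempty (inj₁ (() , _))
  for-nonempty (inj₂ (_ , balanced-b)) = balanced-b

mainTheorem6 :
    (Σ ℕ λ k → Σ ℕ λ n → Σ (Predicate k (suc n)) λ P →
       WeaklyRegular P × ¬ WeaklyRegular (Not P))
    × ((k n : ℕ) (P Q : Predicate k (suc n)) →
       WeaklyRegular P → WeaklyRegular Q → WeaklyRegular (Or P Q))
    × (Σ ℕ λ k → Σ ℕ λ n → Σ (Predicate k (suc n)) λ P → Σ (Predicate k (suc n)) λ Q →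
       WeaklyRegular P × WeaklyRegular Q × ¬ WeaklyRegular (And P Q))
    × ((k n : ℕ) (P : Predicate k (suc (suc n))) →
       WeaklyRegular P → WeaklyRegular (Exists₁ P))
    × (Σ ℕ λ k → Σ ℕ λ n → Σ (Predicate k (suc (suc n))) λ P →
       WeaklyRegular P × ¬ WeaklyRegular (Forall₁ P))
mainTheorem6 =
    (2 , 1 , Or (Unbalanced a) (Unbalanced b) ,
     or-weakly-regular (unbalanced-weakly-regular a) (unbalanced-weakly-regular b) ,
     not-weakly-regular complement-balanced)
  , (λ k n P Q → or-weakly-regular)
  , (2 , 1 , Exists₁ (Guarded true a) , Exists₁ (Guarded true b) ,
     exists-weakly-regular (guarded-weakly-regular true a) , exists-weakly-regular (guarded-weakly-regular true b) ,
     not-weakly-regular conjunction-balanced)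
  , (λ k n P → exists-weakly-regular)
  , (2 , 1 , Or (Guarded true a) (Guarded false b) ,
     or-weakly-regular (guarded-weakly-regular true a) (guarded-weakly-regular false b) ,
     not-weakly-regular universal-balanced)
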